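{- Let $n\ge 1$ and $\sigma\in S_n$. Write $\sigma=M_1\,w_1\,M_2\,w_2\,\cdots\,M_k\,w_k$, where $M_1<M_2<\cdots<M_k$ are the left-to-right maxima of $\sigma$ (so $M_k=n$) and $w_1,\dots,w_k$ are possibly empty words. Let $l_i$ denote the length of $w_i$. Then: (a) $\sigma\in Av(3214,3241,4213,4231)$ if and only if the renormalization of $w_k$ is a permutation in $Av(231,213)$, and, if $k>1$, the juxtaposition $w_1w_2\cdots w_{k-1}$ consists of the smallest $l_1+\cdots+l_{k-1}$ elements of $[n-1]\setminus\{M_1,\dots,M_{k-1}\}$, listed in increasing order. In particular, in this case the renormalization of $\alpha=M_1\,w_1\,\cdots\,M_{k-1}\,w_{k-1}$ avoids $321$. (b) $\sigma\in Av(3124,3142,4123,4132)$ if and only if the renormalization of $w_k$ is a permutation in $Av(123,132)$, and, if $k>1$, for every $i\le k-1$ the word $w_i$ consists of the $l_i$ greatest symbols that are less than $M_i$ and do not occur in $\sigma$ before $w_i$, listed in decreasing order. In particular, in this case the renormalization of $\alpha=M_1\,w_1\,\cdots\,M_{k-1}\,w_{k-1}$ avoids $312$.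
   Context: A permutation $\sigma$ contains a permutation $\tau$ if some subsequence of $\sigma$ has the same relative order as $\tau$; otherwise $\sigma$ avoids $\tau$. $Av(B)$ is the set of permutations avoiding every pattern in $B$, and $S_n(B)=Av(B)\cap S_n$. An entry $\sigma(i)$ is a left-to-right maximum if $\sigma(i)\ge\sigma(j)$ for all $j\le i$. The renormalization of a word of distinct integers is the permutation with the same relative order. $[m]=\{1,\dots,m\}$. -}

module Defs where

open import Data.Nat using (ℕ; zero; suc; _<_; _∸_; _<?_; _≟_)
open import Data.Product using (_×_; _,_; ∃)
open import Data.Unit using (⊤)
open import Data.Empty using (⊥)
open import Data.List using (List; []; _∷_; _++_; map; upTo; filter; length; take; reverse)
open import Data.List.Relation.Unary.All using (All)
open import Data.List.Relation.Binary.Pointwise using (Pointwise)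
open import Data.List.Relation.Binary.Sublist.Propositional using (_⊆_)
open import Data.List.Membership.DecPropositional _≟_ using (_∈?_)
open import Relation.Nullary using (¬_; ¬?)
open import Relation.Binary.PropositionalEquality using (_≡_)
open import Function.Bundles using (_⇔_)

-- Words and permutations are lists of natural numbers; a permutation of
-- length n is a list that is a rearrangement of [1..n].

interval : ℕ → List ℕ
interval m = map suc (upTo m)

SameOrder : List ℕ → List ℕ → Set
SameOrder [] [] = ⊤
SameOrder [] (_ ∷ _) = ⊥
SameOrder (_ ∷ _) [] = ⊥
SameOrder (a ∷ u) (b ∷ v) =
  Pointwise (λ c d → (a < c ⇔ b < d) × (c < a ⇔ d < b)) u v × SameOrder u v

Contains : List ℕ → List ℕ → Set
Contains σ τ = ∃ λ s → (s ⊆ σ) × SameOrder s τ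

Avoids : List ℕ → List ℕ → Set
Avoids σ τ = ¬ Contains σ τ

AvoidsAll : List ℕ → List (List ℕ) → Set
AvoidsAll σ B = All (Avoids σ) B

rank : List ℕ → ℕ → ℕ
rank w x = length (filter (_<? x) w)

renorm : List ℕ → List ℕ
renorm w = map (λ x → suc (rank w x)) w

flatten : List (ℕ × List ℕ) → List ℕ
flatten [] = []
flatten ((M , w) ∷ bs) = M ∷ w ++ flatten bs

-- Hence M₁,…,M_k are exactly the left-to-right maxima of flatten bs
-- (the decomposition σ = M₁ w₁ ⋯ M_k w_k of the paper).
LRDecomp : ℕ → List (ℕ × List ℕ) → Set
LRDecomp m [] = ⊤
LRDecomp m ((M , w) ∷ bs) = (m < M) × All (_< M) w × LRDecomp M bs

maxima : List (ℕ × List ℕ) → List ℕ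
maxima [] = []
maxima ((M , _) ∷ bs) = M ∷ maxima bs

words : List (ℕ × List ℕ) → List ℕ
words [] = []
words ((_ , w) ∷ bs) = w ++ words bs

CondA : ℕ → List (ℕ × List ℕ) → Set
CondA n bs =
  words bs ≡ take (length (words bs))
                  (filter (λ x → ¬? (x ∈? maxima bs)) (interval (n ∸ 1)))

-- Condition of part (b), with p = the part of σ before the current block:
-- each wᵢ consists of the lᵢ greatest symbols < Mᵢ not occurring in σ before
-- wᵢ (i.e. not in p ++ [Mᵢ]), listed in decreasing order.
CondB : List ℕ → List (ℕ × List ℕ) → Set
CondB p [] = ⊤
CondB p ((M , w) ∷ bs) =
  (w ≡ take (length w)
            (reverse (filter (λ x → ¬? (x ∈? (p ++ M ∷ []))) (interval (M ∸ 1)))))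
  × CondB (p ++ M ∷ w) bs

p321 p312 p231 p213 p123 p132 : List ℕ
p321 = 3 ∷ 2 ∷ 1 ∷ []
p312 = 3 ∷ 1 ∷ 2 ∷ []
p231 = 2 ∷ 3 ∷ 1 ∷ []
p213 = 2 ∷ 1 ∷ 3 ∷ []
p123 = 1 ∷ 2 ∷ 3 ∷ []
p132 = 1 ∷ 3 ∷ 2 ∷ []

basisA basisB : List (List ℕ)
basisA = (3 ∷ 2 ∷ 1 ∷ 4 ∷ []) ∷ (3 ∷ 2 ∷ 4 ∷ 1 ∷ []) ∷ (4 ∷ 2 ∷ 1 ∷ 3 ∷ []) ∷ (4 ∷ 2 ∷ 3 ∷ 1 ∷ []) ∷ []
basisB = (3 ∷ 1 ∷ 2 ∷ 4 ∷ []) ∷ (3 ∷ 1 ∷ 4 ∷ 2 ∷ []) ∷ (4 ∷ 1 ∷ 2 ∷ 3 ∷ []) ∷ (4 ∷ 1 ∷ 3 ∷ 2 ∷ []) ∷ []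

module Submission where

-- Both bases describe one entry with a fixed configuration around it:
--   σ avoids basis (a)  ⇔  there are no c … b … {a, d} (a, d in either order)
--                           with a < b < c and b < d            (ConfigA);
--   σ avoids basis (b)  ⇔  there are no c … a … {b, d} (b, d in either order)
--                           with a < b < c and b < d            (ConfigB);
-- this holds for every duplicate-free word.  For σ = α Mk wk with Mk = n, the conditions on wk and on α follow by
-- putting Mk in front of, or behind, an occurrence of a 3-letter pattern.  The
-- conditions on the words wᵢ say that they are prefixes of explicit sorted
-- lists; they follow from the absence of ConfigA / ConfigB via the lemma "a
-- sorted, downward-closed part of a sorted list L is a prefix of L", applied
-- block by block.  Conversely the conditions exclude ConfigA / ConfigB, by
-- cases on where its middle entry lies.

open import Defs
open import Data.Bool using (T)
open import Data.Empty using (⊥; ⊥-elim)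
open import Data.Nat using (ℕ; suc; _<_; _≤_; _∸_; _<?_; _≟_; _<ᵇ_; z≤n; s≤s; s≤s⁻¹)
open import Data.Nat.Properties
open import Data.Product using (_×_; _,_; ∃; proj₁; proj₂)
open import Data.Sum using (_⊎_; inj₁; inj₂)
open import Data.Unit using (tt)
open import Data.List using (List; []; _∷_; _++_; map; filter; length; take; reverse)
import Data.List.Properties as ListP
open import Data.List.Relation.Unary.All as All using (All; []; _∷_)
import Data.List.Relation.Unary.All.Properties as AllP
open import Data.List.Relation.Unary.Any using (here; there)
import Data.List.Relation.Unary.Any.Properties as AnyP
open import Data.List.Relation.Unary.AllPairs using (AllPairs; []; _∷_)
import Data.List.Relation.Unary.AllPairs.Properties as AllPairsP
open import Data.List.Relation.Unary.Unique.Propositional using (Unique)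
import Data.List.Relation.Unary.Unique.Propositional.Properties as UniqueP
open import Data.List.Membership.Propositional using (_∈_; _∉_)
open import Data.List.Membership.Propositional.Properties
  using (∈-++⁻; ∈-++⁺ˡ; ∈-++⁺ʳ; ∈-map⁺; ∈-map⁻; ∈-upTo⁺; ∈-upTo⁻; ∈-filter⁺; ∈-filter⁻; ∉[])
open import Data.List.Membership.DecPropositional _≟_ using (_∈?_)
open import Data.List.Relation.Binary.Sublist.Propositional
  using (_⊆_; []; _∷_; _∷ʳ_; ⊆-refl; ⊆-trans; lookup; from∈; minimum)
import Data.List.Relation.Binary.Sublist.Propositional.Properties as SublistP
open import Data.List.Relation.Binary.Pointwise as PointwiseP using (Pointwise; []; _∷_)
import Data.List.Relation.Binary.Pointwise.Properties as PointwiseProps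
open import Data.List.Relation.Binary.Permutation.Propositional using (_↭_; ↭-sym; ↭⇒↭ₛ)
open import Data.List.Relation.Binary.Permutation.Propositional.Properties using (∈-resp-↭)
import Data.List.Relation.Binary.Permutation.Setoid.Properties as PermutationP
open import Relation.Binary using (Tri; tri<; tri≈; tri>)
open import Relation.Binary.PropositionalEquality
  using (_≡_; _≢_; refl; sym; trans; cong; subst; setoid; module ≡-Reasoning)
open import Relation.Nullary using (¬_; ¬?; Dec; yes; no)
open import Function.Bundles using (_⇔_; mk⇔; Equivalence)
import Function.Properties.Equivalence as ⇔

lit< : ∀ {m n} {t : T (m <ᵇ n)} → m < n
lit< {m} {n} {t} = <ᵇ⇒< m n t

below4 : ∀ {a b c} {ta : T (a <ᵇ 4)} {tb : T (b <ᵇ 4)} {tc : T (c <ᵇ 4)} → All (_< 4) (a ∷ b ∷ c ∷ [])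
below4 {ta = ta} {tb} {tc} = lit< {t = ta} ∷ lit< {t = tb} ∷ lit< {t = tc} ∷ []

<⇒≤∸1 : ∀ {y M} → y < M → y ≤ M ∸ 1
<⇒≤∸1 {M = suc _} (s≤s y≤) = y≤

≤∸1⇒< : ∀ {y M} → 0 < M → y ≤ M ∸ 1 → y < M
≤∸1⇒< {M = suc _} _ y≤ = s≤s y≤

Alike : ℕ → ℕ → ℕ → ℕ → Set
Alike a b c d = (a < c ⇔ b < d) × (c < a ⇔ d < b)

rise : ∀ {a b c d} → a < c → b < d → Alike a b c d
rise a<c b<d = mk⇔ (λ _ → b<d) (λ _ → a<c) ,
               mk⇔ (λ c<a → ⊥-elim (<-asym a<c c<a)) (λ d<b → ⊥-elim (<-asym b<d d<b))

fall : ∀ {a b c d} → c < a → d < b → Alike a b c d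
fall c<a d<b = mk⇔ (λ a<c → ⊥-elim (<-asym a<c c<a)) (λ b<d → ⊥-elim (<-asym b<d d<b)) ,
               mk⇔ (λ _ → d<b) (λ _ → c<a)

rise⁻ : ∀ {a b c d} → Alike a b c d → b < d → a < c
rise⁻ e = Equivalence.from (proj₁ e)

fall⁻ : ∀ {a b c d} → Alike a b c d → d < b → c < a
fall⁻ e = Equivalence.from (proj₂ e)

alike-trans : ∀ {a b e c d f} → Alike a b c d → Alike b e d f → Alike a e c f
alike-trans (p , q) (p′ , q′) = ⇔.trans p p′ , ⇔.trans q q′

alike-sym : ∀ {a b c d} → Alike a b c d → Alike b a d c
alike-sym (p , q) = ⇔.sym p , ⇔.sym q

sameOrder-trans : ∀ u v w → SameOrder u v → SameOrder v w → SameOrder u w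
sameOrder-trans [] [] [] _ _ = tt
sameOrder-trans (a ∷ u) (b ∷ v) (c ∷ w) (p , s) (q , t) =
  PointwiseProps.transitive alike-trans p q , sameOrder-trans u v w s t
sameOrder-trans [] [] (_ ∷ _) _ ()
sameOrder-trans [] (_ ∷ _) _ () _
sameOrder-trans (_ ∷ _) [] _ () _
sameOrder-trans (_ ∷ _) (_ ∷ _) [] _ ()

sameOrder-sym : ∀ u v → SameOrder u v → SameOrder v u
sameOrder-sym [] [] _ = tt
sameOrder-sym (a ∷ u) (b ∷ v) (p , s) = PointwiseProps.symmetric alike-sym p , sameOrder-sym u v s
sameOrder-sym [] (_ ∷ _) ()
sameOrder-sym (_ ∷ _) [] ()

sameOrder3 : ∀ {x₁ x₂ x₃ t₁ t₂ t₃} →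
  Alike x₁ t₁ x₂ t₂ → Alike x₁ t₁ x₃ t₃ → Alike x₂ t₂ x₃ t₃ →
  SameOrder (x₁ ∷ x₂ ∷ x₃ ∷ []) (t₁ ∷ t₂ ∷ t₃ ∷ [])
sameOrder3 e₁₂ e₁₃ e₂₃ = (e₁₂ ∷ e₁₃ ∷ []) , (e₂₃ ∷ []) , [] , tt

sameOrder4 : ∀ {x₁ x₂ x₃ x₄ t₁ t₂ t₃ t₄} →
  Alike x₁ t₁ x₂ t₂ → Alike x₁ t₁ x₃ t₃ → Alike x₁ t₁ x₄ t₄ →
  Alike x₂ t₂ x₃ t₃ → Alike x₂ t₂ x₄ t₄ → Alike x₃ t₃ x₄ t₄ →
  SameOrder (x₁ ∷ x₂ ∷ x₃ ∷ x₄ ∷ []) (t₁ ∷ t₂ ∷ t₃ ∷ t₄ ∷ [])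
sameOrder4 e₁₂ e₁₃ e₁₄ e₂₃ e₂₄ e₃₄ =
  (e₁₂ ∷ e₁₃ ∷ e₁₄ ∷ []) , (e₂₃ ∷ e₂₄ ∷ []) , (e₃₄ ∷ []) , [] , tt

occurrence4 : ∀ {σ t₁ t₂ t₃ t₄} → Contains σ (t₁ ∷ t₂ ∷ t₃ ∷ t₄ ∷ []) →
  ∃ λ x₁ → ∃ λ x₂ → ∃ λ x₃ → ∃ λ x₄ →
  (x₁ ∷ x₂ ∷ x₃ ∷ x₄ ∷ [] ⊆ σ) × SameOrder (x₁ ∷ x₂ ∷ x₃ ∷ x₄ ∷ []) (t₁ ∷ t₂ ∷ t₃ ∷ t₄ ∷ [])
occurrence4 (x₁ ∷ x₂ ∷ x₃ ∷ x₄ ∷ [] , occ , so) = x₁ , x₂ , x₃ , x₄ , occ , so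
occurrence4 ([] , _ , ())
occurrence4 (_ ∷ [] , _ , () , _)
occurrence4 (_ ∷ _ ∷ [] , _ , (_ ∷ ()) , _)
occurrence4 (_ ∷ _ ∷ _ ∷ [] , _ , (_ ∷ _ ∷ ()) , _)
occurrence4 (_ ∷ _ ∷ _ ∷ _ ∷ _ ∷ _ , _ , (_ ∷ _ ∷ _ ∷ ()) , _)

contains-mono : ∀ {w σ τ} → w ⊆ σ → Contains w τ → Contains σ τ
contains-mono w⊆σ (s , s⊆w , so) = s , ⊆-trans s⊆w w⊆σ , so

OrderIso : (ℕ → ℕ) → List ℕ → Set
OrderIso f w = ∀ {x y} → x ∈ w → y ∈ w → (x < y ⇔ f x < f y)

orderIso-⊆ : ∀ {f s w} → s ⊆ w → OrderIso f w → OrderIso f s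
orderIso-⊆ s⊆w iso x∈ y∈ = iso (lookup s⊆w x∈) (lookup s⊆w y∈)

sameOrder-image : ∀ f w → OrderIso f w → SameOrder w (map f w)
sameOrder-image f [] iso = tt
sameOrder-image f (a ∷ w) iso =
  head-pairs w there , sameOrder-image f w (λ x∈ y∈ → iso (there x∈) (there y∈))
  where
  head-pairs : ∀ u → (∀ {c} → c ∈ u → c ∈ a ∷ w) → Pointwise (Alike a (f a)) u (map f u)
  head-pairs [] _ = []
  head-pairs (c ∷ u) sub =
    (iso (here refl) (sub (here refl)) , iso (sub (here refl)) (here refl)) ∷ head-pairs u (λ p → sub (there p))

⊆-map⁻ : ∀ (f : ℕ → ℕ) {s} w → s ⊆ map f w → ∃ λ s′ → s′ ⊆ w × s ≡ map f s′
⊆-map⁻ f [] [] = [] , [] , refl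
⊆-map⁻ f (z ∷ w) (_ ∷ʳ s⊆) with ⊆-map⁻ f w s⊆
... | s′ , s′⊆ , eq = s′ , z ∷ʳ s′⊆ , eq
⊆-map⁻ f (z ∷ w) (refl ∷ s⊆) with ⊆-map⁻ f w s⊆
... | s′ , s′⊆ , eq = z ∷ s′ , refl ∷ s′⊆ , cong (f z ∷_) eq

contains-image⁺ : ∀ f w {τ} → OrderIso f w → Contains w τ → Contains (map f w) τ
contains-image⁺ f w {τ} iso (s , s⊆w , so) =
  map f s , SublistP.map⁺ f s⊆w ,
  sameOrder-trans (map f s) s τ (sameOrder-sym s (map f s) (sameOrder-image f s (orderIso-⊆ s⊆w iso))) so

contains-image⁻ : ∀ f w {τ} → OrderIso f w → Contains (map f w) τ → Contains w τ
contains-image⁻ f w {τ} iso (s , s⊆fw , so) with ⊆-map⁻ f w s⊆fw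
... | s′ , s′⊆w , refl =
  s′ , s′⊆w , sameOrder-trans s′ (map f s′) τ (sameOrder-image f s′ (orderIso-⊆ s′⊆w iso)) so

rank-accept : ∀ {z y} w → z < y → rank (z ∷ w) y ≡ suc (rank w y)
rank-accept {z} {y} w z<y = cong length (ListP.filter-accept (_<? y) z<y)

rank-reject : ∀ {z y} w → ¬ z < y → rank (z ∷ w) y ≡ rank w y
rank-reject {z} {y} w z≮y = cong length (ListP.filter-reject (_<? y) z≮y)

rank-mono : ∀ w {x y} → y ≤ x → rank w y ≤ rank w x
rank-mono w {x} {y} y≤x =
  SublistP.length-mono-≤ (SublistP.filter⁺ (_<? y) (_<? x) (λ { refl z<y → <-≤-trans z<y y≤x }) (⊆-refl {x = w}))

rank-strict : ∀ w {x y} → x ∈ w → x < y → rank w x < rank w y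
rank-strict (z ∷ w) {x} {y} (here refl) x<y with z <? x | z <? y
... | yes z<x | _ = ⊥-elim (<-irrefl refl z<x)
... | no z≮x | yes z<y rewrite rank-reject w z≮x | rank-accept w z<y = s≤s (rank-mono w (<⇒≤ x<y))
... | no _ | no z≮y = ⊥-elim (z≮y x<y)
rank-strict (z ∷ w) {x} {y} (there x∈) x<y with z <? x | z <? y
... | yes z<x | yes z<y rewrite rank-accept w z<x | rank-accept w z<y = s≤s (rank-strict w x∈ x<y)
... | yes z<x | no z≮y = ⊥-elim (z≮y (<-trans z<x x<y))
... | no z≮x | yes z<y rewrite rank-reject w z≮x | rank-accept w z<y = m≤n⇒m≤1+n (rank-strict w x∈ x<y)
... | no z≮x | no z≮y rewrite rank-reject w z≮x | rank-reject w z≮y = rank-strict w x∈ x<y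

rank-orderIso : ∀ w → OrderIso (λ x → suc (rank w x)) w
rank-orderIso w {x} {y} x∈ y∈ = mk⇔ (λ x<y → s≤s (rank-strict w x∈ x<y)) reflect
  where
  reflect : suc (rank w x) < suc (rank w y) → x < y
  reflect r with x <? y
  ... | yes x<y = x<y
  ... | no x≮y = ⊥-elim (<-irrefl refl (<-≤-trans (s≤s⁻¹ r) (rank-mono w (≮⇒≥ x≮y))))

contains-renorm⁺ : ∀ w {τ} → Contains w τ → Contains (renorm w) τ
contains-renorm⁺ w = contains-image⁺ _ w (rank-orderIso w)

contains-renorm⁻ : ∀ w {τ} → Contains (renorm w) τ → Contains w τ
contains-renorm⁻ w = contains-image⁻ _ w (rank-orderIso w)

sameOrder-prependMax : ∀ {M m} s τ → All (_< M) s → All (_< m) τ →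
  SameOrder s τ → SameOrder (M ∷ s) (m ∷ τ)
sameOrder-prependMax {M} {m} s τ s<M τ<m so = below s τ s<M τ<m so , so
  where
  below : ∀ u v → All (_< M) u → All (_< m) v → SameOrder u v → Pointwise (Alike M m) u v
  below [] [] _ _ _ = []
  below (c ∷ u) (d ∷ v) (c<M ∷ u<M) (d<m ∷ v<m) (_ , so′) = fall c<M d<m ∷ below u v u<M v<m so′
  below [] (_ ∷ _) _ _ ()
  below (_ ∷ _) [] _ _ ()

sameOrder-appendMax : ∀ {M m} s τ → All (_< M) s → All (_< m) τ →
  SameOrder s τ → SameOrder (s ++ M ∷ []) (τ ++ m ∷ [])
sameOrder-appendMax [] [] [] [] _ = [] , tt
sameOrder-appendMax (a ∷ s) (b ∷ τ) (a<M ∷ s<M) (b<m ∷ τ<m) (p , so) =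
  PointwiseP.++⁺ p (rise a<M b<m ∷ []) , sameOrder-appendMax s τ s<M τ<m so
sameOrder-appendMax [] (_ ∷ _) _ _ ()
sameOrder-appendMax (_ ∷ _) [] _ _ ()

contains-prependMax : ∀ {M m w τ} → All (_< M) w → All (_< m) τ →
  Contains w τ → Contains (M ∷ w) (m ∷ τ)
contains-prependMax {M} {τ = τ} w<M τ<m (s , s⊆w , so) =
  M ∷ s , refl ∷ s⊆w , sameOrder-prependMax s τ (SublistP.All-resp-⊆ s⊆w w<M) τ<m so

contains-appendMax : ∀ {M m w τ} → All (_< M) w → All (_< m) τ →
  Contains w τ → Contains (w ++ M ∷ []) (τ ++ m ∷ [])
contains-appendMax {M} {τ = τ} w<M τ<m (s , s⊆w , so) =
  s ++ M ∷ [] , SublistP.++⁺ s⊆w ⊆-refl , sameOrder-appendMax s τ (SublistP.All-resp-⊆ s⊆w w<M) τ<m so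

Precedes : List ℕ → ℕ → ℕ → Set
Precedes σ x y = x ∷ y ∷ [] ⊆ σ

precedes-∈ˡ : ∀ {σ x y} → Precedes σ x y → x ∈ σ
precedes-∈ˡ xy = lookup xy (here refl)

precedes-∈ʳ : ∀ {σ x y} → Precedes σ x y → y ∈ σ
precedes-∈ʳ xy = lookup xy (there (here refl))

precedes-⊆ : ∀ {x y xs ys} → x ∷ xs ⊆ ys → y ∈ xs → Precedes ys x y
precedes-⊆ (z ∷ʳ xs⊆) y∈ = z ∷ʳ precedes-⊆ xs⊆ y∈
precedes-⊆ (refl ∷ xs⊆) y∈ = refl ∷ from∈ (lookup xs⊆ y∈)

precedes-++ : ∀ {x y} α β → x ∈ α → y ∈ β → Precedes (α ++ β) x y
precedes-++ (z ∷ α) β (here refl) y∈ = refl ∷ SublistP.++⁺ˡ α (from∈ y∈)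
precedes-++ (z ∷ α) β (there x∈) y∈ = z ∷ʳ precedes-++ α β x∈ y∈

head-fresh : ∀ {z x : ℕ} {σ} → Unique (z ∷ σ) → x ∈ σ → z ≢ x
head-fresh (z∉ ∷ _) x∈ = All.lookup z∉ x∈

unique-tail : ∀ {z : ℕ} {σ} → Unique (z ∷ σ) → Unique σ
unique-tail (_ ∷ u) = u

unique-suffix : ∀ (α : List ℕ) {β} → Unique (α ++ β) → Unique β
unique-suffix [] u = u
unique-suffix (z ∷ α) u = unique-suffix α (unique-tail u)

unique-prefix : ∀ (α : List ℕ) {β} → Unique (α ++ β) → Unique α
unique-prefix [] u = []
unique-prefix (z ∷ α) (z∉ ∷ u) = All.tabulate (λ x∈ → All.lookup z∉ (∈-++⁺ˡ x∈)) ∷ unique-prefix α u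

unique-disjoint : ∀ {x} (α β : List ℕ) → Unique (α ++ β) → x ∈ α → x ∉ β
unique-disjoint (z ∷ α) β u (here refl) x∈β = head-fresh u (∈-++⁺ʳ α x∈β) refl
unique-disjoint (z ∷ α) β u (there x∈) x∈β = unique-disjoint α β (unique-tail u) x∈ x∈β

precedes-chain : ∀ {σ x y s} → Unique σ → Precedes σ x y → y ∷ s ⊆ σ → x ∷ y ∷ s ⊆ σ
precedes-chain {z ∷ σ} u (_ ∷ʳ xy) (_ ∷ʳ ys) = z ∷ʳ precedes-chain (unique-tail u) xy ys
precedes-chain {z ∷ σ} u (_ ∷ʳ xy) (refl ∷ _) = ⊥-elim (head-fresh u (precedes-∈ʳ xy) refl)
precedes-chain {z ∷ σ} u (refl ∷ _) (_ ∷ʳ ys) = refl ∷ ys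
precedes-chain {z ∷ σ} u (refl ∷ xy) (refl ∷ _) = ⊥-elim (head-fresh u (lookup xy (here refl)) refl)

precedes-trans : ∀ {σ x y z} → Unique σ → Precedes σ x y → Precedes σ y z → Precedes σ x z
precedes-trans u xy yz = ⊆-trans (refl ∷ (_ ∷ʳ ⊆-refl)) (precedes-chain u xy yz)

precedes-total : ∀ {σ x y} → x ∈ σ → y ∈ σ → x ≢ y → Precedes σ x y ⊎ Precedes σ y x
precedes-total (here refl) (here refl) x≢y = ⊥-elim (x≢y refl)
precedes-total (here refl) (there y∈) _ = inj₁ (refl ∷ from∈ y∈)
precedes-total (there x∈) (here refl) _ = inj₂ (refl ∷ from∈ x∈)
precedes-total {z ∷ σ} (there x∈) (there y∈) x≢y with precedes-total x∈ y∈ x≢y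
... | inj₁ xy = inj₁ (z ∷ʳ xy)
... | inj₂ yx = inj₂ (z ∷ʳ yx)

precedes-asym : ∀ {σ x y} → Unique σ → Precedes σ x y → ¬ Precedes σ y x
precedes-asym {z ∷ σ} u (_ ∷ʳ xy) (_ ∷ʳ yx) = precedes-asym (unique-tail u) xy yx
precedes-asym {z ∷ σ} u (_ ∷ʳ xy) (refl ∷ _) = head-fresh u (precedes-∈ʳ xy) refl
precedes-asym {z ∷ σ} u (refl ∷ _) (_ ∷ʳ yx) = head-fresh u (precedes-∈ʳ yx) refl
precedes-asym {z ∷ σ} u (refl ∷ _) (refl ∷ yx) = head-fresh u (lookup yx (here refl)) refl

precedes-≢ : ∀ {σ x y} → Unique σ → Precedes σ x y → x ≢ y
precedes-≢ u xy refl = precedes-asym u xy xy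

precedes-in-prefix : ∀ {x y} α β → Unique (α ++ β) → Precedes (α ++ β) x y → y ∈ α → Precedes α x y
precedes-in-prefix (z ∷ α) β u (_ ∷ʳ xy) (here refl) = ⊥-elim (head-fresh u (precedes-∈ʳ xy) refl)
precedes-in-prefix (z ∷ α) β u (_ ∷ʳ xy) (there y∈) = z ∷ʳ precedes-in-prefix α β (unique-tail u) xy y∈
precedes-in-prefix (z ∷ α) β u (refl ∷ y⊆) (here refl) = ⊥-elim (head-fresh u (lookup y⊆ (here refl)) refl)
precedes-in-prefix (z ∷ α) β u (refl ∷ _) (there y∈) = refl ∷ from∈ y∈

precedes-in-suffix : ∀ {x y} α β → Unique (α ++ β) → Precedes (α ++ β) x y → x ∈ β → Precedes β x y
precedes-in-suffix [] β u xy _ = xy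
precedes-in-suffix (z ∷ α) β u (_ ∷ʳ xy) x∈ = precedes-in-suffix α β (unique-tail u) xy x∈
precedes-in-suffix (z ∷ α) β u (refl ∷ _) x∈ = ⊥-elim (head-fresh u (∈-++⁺ʳ α x∈) refl)

earlier-in-prefix : ∀ {x y} α β → Unique (α ++ β) → Precedes (α ++ β) y x → x ∈ α → y ∈ α
earlier-in-prefix α β u yx x∈ = precedes-∈ˡ (precedes-in-prefix α β u yx x∈)

sorted-by-position : ∀ {R : ℕ → ℕ → Set} {ws σ} → ws ⊆ σ →
  (∀ {x y} → x ∈ ws → y ∈ ws → Precedes σ x y → R x y) → AllPairs R ws
sorted-by-position {ws = []} _ _ = []
sorted-by-position {ws = w ∷ ws} ws⊆ related =
  All.tabulate (λ y∈ → related (here refl) (there y∈) (⊆-trans (precedes-⊆ ⊆-refl y∈) ws⊆))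
  ∷ sorted-by-position (⊆-trans (w ∷ʳ ⊆-refl) ws⊆) (λ x∈ y∈ → related (there x∈) (there y∈))

allPairs-reverse : ∀ {R : ℕ → ℕ → Set} xs → AllPairs R xs → AllPairs (λ x y → R y x) (reverse xs)
allPairs-reverse [] [] = []
allPairs-reverse (x ∷ xs) (x-R ∷ sorted) rewrite ListP.unfold-reverse x xs =
  AllPairsP.++⁺ (allPairs-reverse xs sorted) ([] ∷ [])
    (All.tabulate (λ y∈ → All.lookup x-R (AnyP.reverse⁻ y∈) ∷ []))

module SortedPrefix {R : ℕ → ℕ → Set} (irrefl : ∀ {x} → ¬ R x x) (asym : ∀ {x y} → R x y → ¬ R y x) where

  take-precedes : ∀ k L → AllPairs R L → ∀ {x y} → x ∈ take k L → y ∈ L → R y x → Precedes (take k L) y x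
  take-precedes (suc k) (z ∷ L) _ (here refl) (here refl) z-R-z = ⊥-elim (irrefl z-R-z)
  take-precedes (suc k) (z ∷ L) (z-R ∷ _) (here refl) (there y∈) y-R-z = ⊥-elim (asym y-R-z (All.lookup z-R y∈))
  take-precedes (suc k) (z ∷ L) _ (there x∈) (here refl) _ = refl ∷ from∈ x∈
  take-precedes (suc k) (z ∷ L) (_ ∷ sorted) (there x∈) (there y∈) y-R-x =
    z ∷ʳ take-precedes k L sorted x∈ y∈ y-R-x

  downset-prefix : ∀ w L → AllPairs R L → AllPairs R w → (∀ {x} → x ∈ w → x ∈ L) →
    (∀ {x y} → x ∈ w → y ∈ L → R y x → y ∈ w) → w ≡ take (length w) L
  downset-prefix [] L _ _ _ _ = refl
  downset-prefix (x ∷ w) [] _ _ w⊆L _ with w⊆L (here refl)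
  ... | ()
  downset-prefix (x ∷ w) (y ∷ L) (y-R ∷ sortedL) (x-R ∷ sortedw) w⊆L closed with w⊆L (here refl)
  ... | here refl = cong (x ∷_) (downset-prefix w L sortedL sortedw tail⊆ tail-closed)
    where
    tail⊆ : ∀ {z} → z ∈ w → z ∈ L
    tail⊆ z∈ with w⊆L (there z∈)
    ... | here refl = ⊥-elim (irrefl (All.lookup x-R z∈))
    ... | there z∈L = z∈L
    tail-closed : ∀ {a b} → a ∈ w → b ∈ L → R b a → b ∈ w
    tail-closed a∈ b∈ b-R-a with closed (there a∈) (there b∈) b-R-a
    ... | here refl = ⊥-elim (irrefl (All.lookup y-R b∈))
    ... | there b∈w = b∈w
  ... | there x∈L with closed (here refl) (here refl) (All.lookup y-R x∈L)
  ...   | here refl = ⊥-elim (irrefl (All.lookup y-R x∈L))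
  ...   | there y∈w = ⊥-elim (asym (All.lookup y-R x∈L) (All.lookup x-R y∈w))

module Increasing = SortedPrefix {_<_} (<-irrefl refl) <-asym
module Decreasing = SortedPrefix {λ x y → y < x} (<-irrefl refl) <-asym

interval-bounds : ∀ {x} m → x ∈ interval m → 1 ≤ x × x ≤ m
interval-bounds m x∈ with ∈-map⁻ suc x∈
... | i , i∈ , refl = s≤s z≤n , ∈-upTo⁻ i∈

interval-∈ : ∀ {x} m → 1 ≤ x → x ≤ m → x ∈ interval m
interval-∈ {suc i} m _ x≤m = ∈-map⁺ suc (∈-upTo⁺ x≤m)

interval-sorted : ∀ m → AllPairs _<_ (interval m)
interval-sorted m = AllPairsP.map⁺ (AllPairsP.applyUpTo⁺₁ (λ i → i) m (λ i<j _ → s≤s i<j))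

permutation-unique : ∀ {σ} n → σ ↭ interval n → Unique σ
permutation-unique n σ↭ =
  PermutationP.Unique-resp-↭ (setoid ℕ) (↭⇒↭ₛ (↭-sym σ↭)) (UniqueP.map⁺ suc-injective (UniqueP.upTo⁺ n))

lrDecomp-last : ∀ {Mk wk} m bs → LRDecomp m (bs ++ (Mk , wk) ∷ []) →
  LRDecomp m bs × All (_< Mk) (flatten bs) × All (_< Mk) wk × m < Mk
lrDecomp-last m [] (m<Mk , wk<Mk , _) = tt , [] , wk<Mk , m<Mk
lrDecomp-last m ((M , w) ∷ bs) (m<M , w<M , rest) with lrDecomp-last M bs rest
... | lr , bs<Mk , wk<Mk , M<Mk =
  (m<M , w<M , lr) , M<Mk ∷ AllP.++⁺ (All.map (λ x<M → <-trans x<M M<Mk) w<M) bs<Mk , wk<Mk , <-trans m<M M<Mk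

words-⊆ : ∀ bs → words bs ⊆ flatten bs
words-⊆ [] = []
words-⊆ ((M , w) ∷ bs) = M ∷ʳ SublistP.++⁺ ⊆-refl (words-⊆ bs)

maxima-∈ : ∀ {x} bs → x ∈ maxima bs → x ∈ flatten bs
maxima-∈ ((M , w) ∷ bs) (here refl) = here refl
maxima-∈ ((M , w) ∷ bs) (there x∈) = there (∈-++⁺ʳ w (maxima-∈ bs x∈))

maxima-or-words : ∀ {x} bs → x ∈ flatten bs → x ∈ maxima bs ⊎ x ∈ words bs
maxima-or-words ((M , w) ∷ bs) (here refl) = inj₁ (here refl)
maxima-or-words ((M , w) ∷ bs) (there x∈) with ∈-++⁻ w x∈
... | inj₁ x∈w = inj₂ (∈-++⁺ˡ x∈w)
... | inj₂ x∈bs with maxima-or-words bs x∈bs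
...   | inj₁ x∈max = inj₁ (there x∈max)
...   | inj₂ x∈words = inj₂ (∈-++⁺ʳ w x∈words)

maxima-words-disjoint : ∀ {x} bs → Unique (flatten bs) → x ∈ maxima bs → x ∉ words bs
maxima-words-disjoint ((M , w) ∷ bs) u (here refl) x∈ = head-fresh u (lookup (SublistP.++⁺ ⊆-refl (words-⊆ bs)) x∈) refl
maxima-words-disjoint ((M , w) ∷ bs) u (there x∈max) x∈ with ∈-++⁻ w x∈
... | inj₁ x∈w = unique-disjoint w (flatten bs) (unique-tail u) x∈w (maxima-∈ bs x∈max)
... | inj₂ x∈words = maxima-words-disjoint bs (unique-suffix w (unique-tail u)) x∈max x∈words

-- IsBlock p bs q M w: (M , w) is a block of bs, and q is what precedes M in
-- p ++ flatten bs.
data IsBlock : List ℕ → List (ℕ × List ℕ) → List ℕ → ℕ → List ℕ → Set where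
  first : ∀ {p M w bs} → IsBlock p ((M , w) ∷ bs) p M w
  later : ∀ {p M w bs q M′ w′} → IsBlock (p ++ M ∷ w) bs q M′ w′ → IsBlock p ((M , w) ∷ bs) q M′ w′

block-split : ∀ {p bs q M w} → IsBlock p bs q M w → ∃ λ rest → p ++ flatten bs ≡ q ++ M ∷ w ++ rest
block-split {bs = (_ , _) ∷ bs} first = flatten bs , refl
block-split {p} {(M , w) ∷ bs} (later blk) with block-split blk
... | rest , eq = rest , trans (sym (ListP.++-assoc p (M ∷ w) (flatten bs))) eq

block-bounds : ∀ {m p bs q M w} → LRDecomp m bs → All (_≤ m) p → IsBlock p bs q M w →
  All (_< M) q × All (_< M) w
block-bounds (m<M , w<M , _) p≤m first = All.map (λ x≤m → ≤-<-trans x≤m m<M) p≤m , w<M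
block-bounds (m<M , w<M , rest) p≤m (later blk) =
  block-bounds rest (AllP.++⁺ (All.map (λ x≤m → <⇒≤ (≤-<-trans x≤m m<M)) p≤m) (≤-refl ∷ All.map <⇒≤ w<M)) blk

words-block : ∀ {x p} bs → x ∈ words bs → ∃ λ q → ∃ λ M → ∃ λ w → IsBlock p bs q M w × x ∈ w
words-block ((M , w) ∷ bs) x∈ with ∈-++⁻ w x∈
... | inj₁ x∈w = _ , _ , _ , first , x∈w
... | inj₂ x∈words with words-block bs x∈words
...   | q , M′ , w′ , blk , x∈w′ = q , M′ , w′ , later blk , x∈w′

maxima-block : ∀ {M p} bs → M ∈ maxima bs → ∃ λ q → ∃ λ w → IsBlock p bs q M w
maxima-block ((M , w) ∷ bs) (here refl) = _ , _ , first
maxima-block ((M , w) ∷ bs) (there M∈) with maxima-block bs M∈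
... | q , w′ , blk = q , w′ , later blk

greatestFree : List ℕ → ℕ → List ℕ
greatestFree q M = reverse (filter (λ x → ¬? (x ∈? (q ++ M ∷ []))) (interval (M ∸ 1)))

greatestFree-sorted : ∀ q M → AllPairs (λ x y → y < x) (greatestFree q M)
greatestFree-sorted q M =
  allPairs-reverse _ (AllPairsP.filter⁺ (λ x → ¬? (x ∈? (q ++ M ∷ []))) (interval-sorted (M ∸ 1)))

greatestFree-∈ : ∀ {x} q M → x ∈ interval (M ∸ 1) → x ∉ q ++ M ∷ [] → x ∈ greatestFree q M
greatestFree-∈ q M x∈ x∉ = AnyP.reverse⁺ (∈-filter⁺ (λ x → ¬? (x ∈? (q ++ M ∷ []))) x∈ x∉)

greatestFree-∈⁻ : ∀ {x} q M → x ∈ greatestFree q M → x ∈ interval (M ∸ 1) × x ∉ q ++ M ∷ []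
greatestFree-∈⁻ q M x∈ = ∈-filter⁻ (λ x → ¬? (x ∈? (q ++ M ∷ []))) (AnyP.reverse⁻ x∈)

BlockCondB : List ℕ → ℕ → List ℕ → Set
BlockCondB q M w = w ≡ take (length w) (greatestFree q M)

condB-intro : ∀ p bs → (∀ {q M w} → IsBlock p bs q M w → BlockCondB q M w) → CondB p bs
condB-intro p [] _ = tt
condB-intro p ((M , w) ∷ bs) each = each first , condB-intro (p ++ M ∷ w) bs (λ blk → each (later blk))

condB-elim : ∀ {p bs q M w} → CondB p bs → IsBlock p bs q M w → BlockCondB q M w
condB-elim (holds , _) first = holds
condB-elim (_ , rest) (later blk) = condB-elim rest blk

∈-after-head : ∀ {y M : ℕ} q w → y ∈ q ++ M ∷ w → y ∉ q ++ M ∷ [] → y ∈ w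
∈-after-head q w y∈ y∉ with ∈-++⁻ q y∈
... | inj₁ y∈q = ⊥-elim (y∉ (∈-++⁺ˡ y∈q))
... | inj₂ (here refl) = ⊥-elim (y∉ (∈-++⁺ʳ q (here refl)))
... | inj₂ (there y∈w) = y∈w

ConfigA : List ℕ → Set
ConfigA σ = ∃ λ c → ∃ λ b → ∃ λ a → ∃ λ d →
  Precedes σ c b × Precedes σ b a × Precedes σ b d × b < c × a < b × b < d

ConfigB : List ℕ → Set
ConfigB σ = ∃ λ c → ∃ λ a → ∃ λ b → ∃ λ d →
  Precedes σ c a × Precedes σ a b × Precedes σ a d × a < b × b < c × b < d

precedes₁₂ : ∀ {σ x₁ x₂ x₃ x₄} → x₁ ∷ x₂ ∷ x₃ ∷ x₄ ∷ [] ⊆ σ → Precedes σ x₁ x₂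
precedes₁₂ occ = precedes-⊆ occ (here refl)

precedes₂₃ : ∀ {σ x₁ x₂ x₃ x₄} → x₁ ∷ x₂ ∷ x₃ ∷ x₄ ∷ [] ⊆ σ → Precedes σ x₂ x₃
precedes₂₃ occ = precedes-⊆ (SublistP.∷ˡ⁻ occ) (here refl)

precedes₂₄ : ∀ {σ x₁ x₂ x₃ x₄} → x₁ ∷ x₂ ∷ x₃ ∷ x₄ ∷ [] ⊆ σ → Precedes σ x₂ x₄
precedes₂₄ occ = precedes-⊆ (SublistP.∷ˡ⁻ occ) (there (here refl))

-- Each pattern of basis (a) is a ConfigA together with the order of a, d
-- and of c, d; so a word without ConfigA avoids basis (a) ...
noConfigA⇒avoidsA : ∀ {σ} → ¬ ConfigA σ → AvoidsAll σ basisA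
noConfigA⇒avoidsA {σ} noC = cbad lit< lit< lit< ∷ cbda lit< lit< lit< ∷ cbad lit< lit< lit< ∷ cbda lit< lit< lit< ∷ []
  where
  cbad : ∀ {t₁ t₂ t₃ t₄} → t₂ < t₁ → t₃ < t₂ → t₂ < t₄ → Avoids σ (t₁ ∷ t₂ ∷ t₃ ∷ t₄ ∷ [])
  cbad t₂<t₁ t₃<t₂ t₂<t₄ occ with occurrence4 occ
  ... | c , b , a , d , pos , (e₁₂ ∷ _ ∷ _ ∷ []) , (e₂₃ ∷ e₂₄ ∷ []) , _ =
    noC (c , b , a , d , precedes₁₂ pos , precedes₂₃ pos , precedes₂₄ pos ,
         fall⁻ e₁₂ t₂<t₁ , fall⁻ e₂₃ t₃<t₂ , rise⁻ e₂₄ t₂<t₄)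
  cbda : ∀ {t₁ t₂ t₃ t₄} → t₂ < t₁ → t₄ < t₂ → t₂ < t₃ → Avoids σ (t₁ ∷ t₂ ∷ t₃ ∷ t₄ ∷ [])
  cbda t₂<t₁ t₄<t₂ t₂<t₃ occ with occurrence4 occ
  ... | c , b , d , a , pos , (e₁₂ ∷ _ ∷ _ ∷ []) , (e₂₃ ∷ e₂₄ ∷ []) , _ =
    noC (c , b , a , d , precedes₁₂ pos , precedes₂₄ pos , precedes₂₃ pos ,
         fall⁻ e₁₂ t₂<t₁ , fall⁻ e₂₄ t₄<t₂ , rise⁻ e₂₃ t₂<t₃)

avoidsA⇒noConfigA : ∀ {σ} → Unique σ → AvoidsAll σ basisA → ¬ ConfigA σ
avoidsA⇒noConfigA {σ} u (no3214 ∷ no3241 ∷ no4213 ∷ no4231 ∷ []) (c , b , a , d , cb , ba , bd , b<c , a<b , b<d) =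
  complete (precedes-total (precedes-∈ʳ ba) (precedes-∈ʳ bd) (<⇒≢ a<d)) (<-cmp c d)
  where
  a<c = <-trans a<b b<c
  a<d = <-trans a<b b<d
  complete : Precedes σ a d ⊎ Precedes σ d a → Tri (c < d) (c ≡ d) (d < c) → ⊥
  complete _ (tri≈ _ c≡d _) = precedes-≢ u (precedes-trans u cb bd) c≡d
  complete (inj₁ ad) (tri< c<d _ _) = no3214 (_ , precedes-chain u cb (precedes-chain u ba ad) ,
    sameOrder4 (fall b<c lit<) (fall a<c lit<) (rise c<d lit<) (fall a<b lit<) (rise b<d lit<) (rise a<d lit<))
  complete (inj₁ ad) (tri> _ _ d<c) = no4213 (_ , precedes-chain u cb (precedes-chain u ba ad) ,
    sameOrder4 (fall b<c lit<) (fall a<c lit<) (fall d<c lit<) (fall a<b lit<) (rise b<d lit<) (rise a<d lit<))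
  complete (inj₂ da) (tri< c<d _ _) = no3241 (_ , precedes-chain u cb (precedes-chain u bd da) ,
    sameOrder4 (fall b<c lit<) (rise c<d lit<) (fall a<c lit<) (rise b<d lit<) (fall a<b lit<) (fall a<d lit<))
  complete (inj₂ da) (tri> _ _ d<c) = no4231 (_ , precedes-chain u cb (precedes-chain u bd da) ,
    sameOrder4 (fall b<c lit<) (fall d<c lit<) (fall a<c lit<) (rise b<d lit<) (fall a<b lit<) (fall a<d lit<))

noConfigB⇒avoidsB : ∀ {σ} → ¬ ConfigB σ → AvoidsAll σ basisB
noConfigB⇒avoidsB {σ} noC = cabd lit< lit< lit< ∷ cadb lit< lit< lit< ∷ cabd lit< lit< lit< ∷ cadb lit< lit< lit< ∷ []
  where
  cabd : ∀ {t₁ t₂ t₃ t₄} → t₂ < t₃ → t₃ < t₁ → t₃ < t₄ → Avoids σ (t₁ ∷ t₂ ∷ t₃ ∷ t₄ ∷ [])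
  cabd t₂<t₃ t₃<t₁ t₃<t₄ occ with occurrence4 occ
  ... | c , a , b , d , pos , (_ ∷ e₁₃ ∷ _ ∷ []) , (e₂₃ ∷ _ ∷ []) , (e₃₄ ∷ []) , _ =
    noC (c , a , b , d , precedes₁₂ pos , precedes₂₃ pos , precedes₂₄ pos ,
         rise⁻ e₂₃ t₂<t₃ , fall⁻ e₁₃ t₃<t₁ , rise⁻ e₃₄ t₃<t₄)
  cadb : ∀ {t₁ t₂ t₃ t₄} → t₂ < t₄ → t₄ < t₁ → t₄ < t₃ → Avoids σ (t₁ ∷ t₂ ∷ t₃ ∷ t₄ ∷ [])
  cadb t₂<t₄ t₄<t₁ t₄<t₃ occ with occurrence4 occ
  ... | c , a , d , b , pos , (_ ∷ _ ∷ e₁₄ ∷ []) , (_ ∷ e₂₄ ∷ []) , (e₃₄ ∷ []) , _ =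
    noC (c , a , b , d , precedes₁₂ pos , precedes₂₄ pos , precedes₂₃ pos ,
         rise⁻ e₂₄ t₂<t₄ , fall⁻ e₁₄ t₄<t₁ , fall⁻ e₃₄ t₄<t₃)

avoidsB⇒noConfigB : ∀ {σ} → Unique σ → AvoidsAll σ basisB → ¬ ConfigB σ
avoidsB⇒noConfigB {σ} u (no3124 ∷ no3142 ∷ no4123 ∷ no4132 ∷ []) (c , a , b , d , ca , ab , ad , a<b , b<c , b<d) =
  complete (precedes-total (precedes-∈ʳ ab) (precedes-∈ʳ ad) (<⇒≢ b<d)) (<-cmp c d)
  where
  a<c = <-trans a<b b<c
  a<d = <-trans a<b b<d
  complete : Precedes σ b d ⊎ Precedes σ d b → Tri (c < d) (c ≡ d) (d < c) → ⊥
  complete _ (tri≈ _ c≡d _) = precedes-≢ u (precedes-trans u ca ad) c≡d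
  complete (inj₁ bd) (tri< c<d _ _) = no3124 (_ , precedes-chain u ca (precedes-chain u ab bd) ,
    sameOrder4 (fall a<c lit<) (fall b<c lit<) (rise c<d lit<) (rise a<b lit<) (rise a<d lit<) (rise b<d lit<))
  complete (inj₁ bd) (tri> _ _ d<c) = no4123 (_ , precedes-chain u ca (precedes-chain u ab bd) ,
    sameOrder4 (fall a<c lit<) (fall b<c lit<) (fall d<c lit<) (rise a<b lit<) (rise a<d lit<) (rise b<d lit<))
  complete (inj₂ db) (tri< c<d _ _) = no3142 (_ , precedes-chain u ca (precedes-chain u ad db) ,
    sameOrder4 (fall a<c lit<) (rise c<d lit<) (fall b<c lit<) (rise a<d lit<) (rise a<b lit<) (fall b<d lit<))
  complete (inj₂ db) (tri> _ _ d<c) = no4132 (_ , precedes-chain u ca (precedes-chain u ad db) ,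
    sameOrder4 (fall a<c lit<) (fall d<c lit<) (fall b<c lit<) (rise a<d lit<) (rise a<b lit<) (fall b<d lit<))

-- Throughout, σ = α Mk wk is a permutation of [n], where αbs decomposes
-- α = M₁ w₁ ⋯ M_{k-1} w_{k-1} into left-to-right maxima and Mk = n is the
-- last maximum.

module Decomposition (n : ℕ) (αbs : List (ℕ × List ℕ)) (Mk : ℕ) (wk : List ℕ)
  (σ↭ : flatten αbs ++ Mk ∷ wk ↭ interval n)
  (lr : LRDecomp 0 (αbs ++ (Mk , wk) ∷ [])) where

  α : List ℕ
  α = flatten αbs

  σ : List ℕ
  σ = α ++ Mk ∷ wk

  U : Unique σ
  U = permutation-unique n σ↭

  Uwk : Unique wk
  Uwk = unique-tail (unique-suffix α U)

  bounded : ∀ {x} → x ∈ σ → 1 ≤ x × x ≤ n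
  bounded x∈ = interval-bounds n (∈-resp-↭ σ↭ x∈)

  interval-∈σ : ∀ {y} N → N ≤ n → y ∈ interval (N ∸ 1) → y ∈ σ
  interval-∈σ N N≤n y∈ with interval-bounds (N ∸ 1) y∈
  ... | 1≤y , y≤ = ∈-resp-↭ (↭-sym σ↭) (interval-∈ n 1≤y (≤-trans y≤ (≤-trans (m∸n≤m N 1) N≤n)))

  σ-∈interval : ∀ {y N} → y ∈ σ → y < N → y ∈ interval (N ∸ 1)
  σ-∈interval {N = N} y∈ y<N = interval-∈ (N ∸ 1) (proj₁ (bounded y∈)) (<⇒≤∸1 y<N)

  lrα : LRDecomp 0 αbs
  lrα = proj₁ (lrDecomp-last 0 αbs lr)

  α<Mk : All (_< Mk) α
  α<Mk = proj₁ (proj₂ (lrDecomp-last 0 αbs lr))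

  wk<Mk : All (_< Mk) wk
  wk<Mk = proj₁ (proj₂ (proj₂ (lrDecomp-last 0 αbs lr)))

  Mk≤n : Mk ≤ n
  Mk≤n = proj₂ (bounded (∈-++⁺ʳ α (here refl)))

  α⊆σ : α ⊆ σ
  α⊆σ = SublistP.++⁺ʳ (Mk ∷ wk) ⊆-refl

  words-in-α : ∀ {x} → x ∈ words αbs → x ∈ α
  words-in-α = lookup (words-⊆ αbs)

  -- A word entry shows that k > 1, so that the prefix conditions apply.
  nonempty : ∀ {x} → x ∈ words αbs → αbs ≢ []
  nonempty x∈ αbs≡[] = ∉[] (subst (λ bs → _ ∈ words bs) αbs≡[] x∈)

  data Location (x : ℕ) : Set where
    in-α  : x ∈ α → Location x
    is-Mk : x ≡ Mk → Location x
    in-wk : x ∈ wk → Location x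

  locate : ∀ {x} → x ∈ σ → Location x
  locate x∈ with ∈-++⁻ α x∈
  ... | inj₁ x∈α = in-α x∈α
  ... | inj₂ (here x≡Mk) = is-Mk x≡Mk
  ... | inj₂ (there x∈wk) = in-wk x∈wk

  σ≤Mk : ∀ {x} → x ∈ σ → x ≤ Mk
  σ≤Mk x∈ with locate x∈
  ... | in-α x∈α = <⇒≤ (All.lookup α<Mk x∈α)
  ... | is-Mk refl = ≤-refl
  ... | in-wk x∈wk = <⇒≤ (All.lookup wk<Mk x∈wk)

  before-Mk : ∀ {x} → x ∈ α → Precedes σ x Mk
  before-Mk x∈ = precedes-++ α (Mk ∷ wk) x∈ (here refl)

  after-wk : ∀ {x y} → x ∈ wk → Precedes σ x y → y ∈ wk
  after-wk x∈ xy with locate (precedes-∈ʳ xy)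
  ... | in-α y∈α = ⊥-elim (precedes-asym U (precedes-++ α (Mk ∷ wk) y∈α (there x∈)) xy)
  ... | is-Mk refl = ⊥-elim (precedes-asym U (SublistP.++⁺ˡ α (refl ∷ from∈ x∈)) xy)
  ... | in-wk y∈wk = y∈wk

  precedes-wk : ∀ {x y} → x ∈ wk → Precedes σ x y → Precedes wk x y
  precedes-wk x∈ xy =
    precedes-in-suffix (Mk ∷ []) wk (unique-suffix α U) (precedes-in-suffix α (Mk ∷ wk) U xy (there x∈)) x∈

  -- Putting Mk in front of an occurrence of τ in wk (resp. behind one in α)
  -- gives an occurrence of 4τ (resp. τ4) in σ.
  wk-avoids : ∀ τ → All (_< 4) τ → Avoids σ (4 ∷ τ) → Avoids (renorm wk) τ
  wk-avoids τ τ<4 no4τ occ =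
    no4τ (contains-mono (SublistP.++⁺ˡ α ⊆-refl) (contains-prependMax wk<Mk τ<4 (contains-renorm⁻ wk occ)))

  α-avoids : ∀ τ → All (_< 4) τ → Avoids σ (τ ++ 4 ∷ []) → Avoids (renorm α) τ
  α-avoids τ τ<4 noτ4 occ =
    noτ4 (contains-mono (SublistP.++⁺ ⊆-refl (refl ∷ minimum wk)) (contains-appendMax α<Mk τ<4 (contains-renorm⁻ α occ)))

  module Block {q M w} (blk : IsBlock [] αbs q M w) where

    rest : List ℕ
    rest = proj₁ (block-split blk)

    α-split : α ≡ q ++ M ∷ w ++ rest
    α-split = proj₂ (block-split blk)

    q<M : All (_< M) q
    q<M = proj₁ (block-bounds lrα [] blk)

    w<M : All (_< M) w
    w<M = proj₂ (block-bounds lrα [] blk)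

    σ-split : σ ≡ q ++ M ∷ w ++ rest ++ Mk ∷ wk
    σ-split = begin
      α ++ Mk ∷ wk                   ≡⟨ cong (_++ Mk ∷ wk) α-split ⟩
      (q ++ M ∷ w ++ rest) ++ Mk ∷ wk ≡⟨ ListP.++-assoc q (M ∷ w ++ rest) (Mk ∷ wk) ⟩
      q ++ M ∷ (w ++ rest) ++ Mk ∷ wk ≡⟨ cong (λ t → q ++ M ∷ t) (ListP.++-assoc w rest (Mk ∷ wk)) ⟩
      q ++ M ∷ w ++ rest ++ Mk ∷ wk   ∎
      where open ≡-Reasoning

    cut-before-w : σ ≡ (q ++ M ∷ []) ++ w ++ rest ++ Mk ∷ wk
    cut-before-w = trans σ-split (sym (ListP.++-assoc q (M ∷ []) _))

    cut-after-w : σ ≡ (q ++ M ∷ w) ++ rest ++ Mk ∷ wk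
    cut-after-w = trans σ-split (sym (ListP.++-assoc q (M ∷ w) _))

    w⊆α : w ⊆ α
    w⊆α = subst (w ⊆_) (sym α-split) (SublistP.++⁺ˡ q (M ∷ʳ SublistP.++⁺ʳ rest ⊆-refl))

    w⊆σ : w ⊆ σ
    w⊆σ = ⊆-trans w⊆α α⊆σ

    M∈α : M ∈ α
    M∈α = subst (M ∈_) (sym α-split) (∈-++⁺ʳ q (here refl))

    M<Mk : M < Mk
    M<Mk = All.lookup α<Mk M∈α

    head-before-w : ∀ {x y} → y ∈ q ++ M ∷ [] → x ∈ w → Precedes σ y x
    head-before-w y∈ x∈ =
      subst (λ t → Precedes t _ _) (sym cut-before-w) (precedes-++ (q ++ M ∷ []) _ y∈ (∈-++⁺ˡ x∈))

    M-before-w : ∀ {x} → x ∈ w → Precedes σ M x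
    M-before-w = head-before-w (∈-++⁺ʳ q (here refl))

    before-w : ∀ {x y} → x ∈ w → Precedes σ y x → y ∈ q ++ M ∷ w
    before-w x∈ yx = earlier-in-prefix (q ++ M ∷ w) _ (subst Unique cut-after-w U)
      (subst (λ t → Precedes t _ _) cut-after-w yx) (∈-++⁺ʳ q (there x∈))

    before-M : ∀ {y} → Precedes σ y M → y ∈ q
    before-M yM with ∈-++⁻ q (earlier-in-prefix (q ++ M ∷ []) _ (subst Unique cut-before-w U)
                        (subst (λ t → Precedes t _ _) cut-before-w yM) (∈-++⁺ʳ q (here refl)))
    ... | inj₁ y∈q = y∈q
    ... | inj₂ (here refl) = ⊥-elim (precedes-≢ U yM refl)

    w-fresh : ∀ {x} → x ∈ w → x ∉ q ++ M ∷ []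
    w-fresh x∈ x∈head = precedes-≢ U (head-before-w x∈head x∈) refl

    ≤M-before-w : ∀ {y} → y ∈ q ++ M ∷ w → y ≤ M
    ≤M-before-w y∈ with ∈-++⁻ q y∈
    ... | inj₁ y∈q = <⇒≤ (All.lookup q<M y∈q)
    ... | inj₂ (here refl) = ≤-refl
    ... | inj₂ (there y∈w) = <⇒≤ (All.lookup w<M y∈w)

    -- Without ConfigA, all smaller entries come before an entry x of w:
    -- otherwise M x y Mk would be one.
    smaller-before : ¬ ConfigA σ → ∀ {x y} → x ∈ w → y ∈ σ → y < x → Precedes σ y x
    smaller-before noC {x} {y} x∈ y∈ y<x with precedes-total y∈ (lookup w⊆σ x∈) (<⇒≢ y<x)
    ... | inj₁ yx = yx
    ... | inj₂ xy = ⊥-elim (noC (M , x , y , Mk , M-before-w x∈ , xy , before-Mk (lookup w⊆α x∈) ,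
                                 All.lookup w<M x∈ , y<x , <-trans (All.lookup w<M x∈) M<Mk))

    -- Without ConfigB, all larger entries below M come before an entry x of
    -- w: otherwise M x y Mk would be one.
    larger-before : ¬ ConfigB σ → ∀ {x y} → x ∈ w → y ∈ σ → x < y → y < M → Precedes σ y x
    larger-before noC {x} {y} x∈ y∈ x<y y<M with precedes-total y∈ (lookup w⊆σ x∈) (>⇒≢ x<y)
    ... | inj₁ yx = yx
    ... | inj₂ xy = ⊥-elim (noC (M , x , y , Mk , M-before-w x∈ , xy , before-Mk (lookup w⊆α x∈) ,
                                 x<y , y<M , <-trans y<M M<Mk))

    condB-holds : ¬ ConfigB σ → BlockCondB q M w
    condB-holds noC = Decreasing.downset-prefix w (greatestFree q M) (greatestFree-sorted q M)
                        (sorted-by-position w⊆σ decreasing) w⊆free closed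
      where
      decreasing : ∀ {x y} → x ∈ w → y ∈ w → Precedes σ x y → y < x
      decreasing {x} {y} x∈ y∈ xy with <-cmp x y
      ... | tri< x<y _ _ = ⊥-elim (precedes-asym U xy
                              (larger-before noC x∈ (lookup w⊆σ y∈) x<y (All.lookup w<M y∈)))
      ... | tri≈ _ x≡y _ = ⊥-elim (precedes-≢ U xy x≡y)
      ... | tri> _ _ y<x = y<x
      w⊆free : ∀ {x} → x ∈ w → x ∈ greatestFree q M
      w⊆free x∈ = greatestFree-∈ q M (σ-∈interval (lookup w⊆σ x∈) (All.lookup w<M x∈)) (w-fresh x∈)
      closed : ∀ {x y} → x ∈ w → y ∈ greatestFree q M → x < y → y ∈ w
      closed x∈ y∈ x<y with greatestFree-∈⁻ q M y∈
      ... | y∈int , y∉ = ∈-after-head q w (before-w x∈ (larger-before noC x∈ y∈σ x<y y<M)) y∉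
        where
        y∈σ = interval-∈σ M (<⇒≤ (<-≤-trans M<Mk Mk≤n)) y∈int
        y<M = ≤∸1⇒< (proj₁ (bounded (lookup α⊆σ M∈α))) (proj₂ (interval-bounds (M ∸ 1) y∈int))

    -- Conversely, under the block condition no c … x … y with x ∈ w and
    -- x < y < c exists: y would be a free symbol below M, hence in w before x.
    condB-excludes : BlockCondB q M w → ∀ {c x y} → x ∈ w → Precedes σ c x → Precedes σ x y → x < y → y < c → ⊥
    condB-excludes prefix {c} {x} {y} x∈ cx xy x<y y<c = precedes-asym U xy y-before-x
      where
      y∈free : y ∈ greatestFree q M
      y∈free = greatestFree-∈ q M (σ-∈interval (precedes-∈ʳ xy) (<-≤-trans y<c (≤M-before-w (before-w x∈ cx))))
                               (λ y∈head → precedes-asym U xy (head-before-w y∈head x∈))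
      y-before-x : Precedes σ y x
      y-before-x = ⊆-trans (subst (λ t → Precedes t y x) (sym prefix)
        (Decreasing.take-precedes (length w) (greatestFree q M) (greatestFree-sorted q M) (subst (x ∈_) prefix x∈) y∈free x<y)) w⊆σ

  maximum-precedes : ∀ {y M} → M ∈ maxima αbs → Precedes σ y M → y < M
  maximum-precedes M∈ yM with maxima-block αbs M∈
  ... | q , w , blk = All.lookup (Block.q<M blk) (Block.before-M blk yM)

  notMax? : ∀ x → Dec (x ∉ maxima αbs)
  notMax? x = ¬? (x ∈? maxima αbs)

  freeA : List ℕ
  freeA = filter notMax? (interval (n ∸ 1))

  freeA-sorted : AllPairs _<_ freeA
  freeA-sorted = AllPairsP.filter⁺ notMax? (interval-sorted (n ∸ 1))

  freeA-∈ : ∀ {x} → x ∈ σ → x < Mk → x ∉ maxima αbs → x ∈ freeA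
  freeA-∈ x∈ x<Mk x∉ = ∈-filter⁺ notMax? (σ-∈interval x∈ (<-≤-trans x<Mk Mk≤n)) x∉

  smaller-before-words : ¬ ConfigA σ → ∀ {x y} → x ∈ words αbs → y ∈ σ → y < x → Precedes σ y x
  smaller-before-words noC x∈ with words-block αbs x∈
  ... | q , M , w , blk , x∈w = Block.smaller-before blk noC x∈w

  condA : ¬ ConfigA σ → CondA n αbs
  condA noC = Increasing.downset-prefix (words αbs) freeA freeA-sorted
                (sorted-by-position (⊆-trans (words-⊆ αbs) α⊆σ) increasing) words⊆free closed
    where
    increasing : ∀ {x y} → x ∈ words αbs → y ∈ words αbs → Precedes σ x y → x < y
    increasing {x} {y} x∈ _ xy with <-cmp x y
    ... | tri< x<y _ _ = x<y
    ... | tri≈ _ x≡y _ = ⊥-elim (precedes-≢ U xy x≡y)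
    ... | tri> _ _ y<x = ⊥-elim (precedes-asym U xy (smaller-before-words noC x∈ (precedes-∈ʳ xy) y<x))
    words⊆free : ∀ {x} → x ∈ words αbs → x ∈ freeA
    words⊆free x∈ = freeA-∈ (lookup α⊆σ (words-in-α x∈)) (All.lookup α<Mk (words-in-α x∈))
                            (λ x∈max → maxima-words-disjoint αbs (unique-prefix α U) x∈max x∈)
    closed : ∀ {x y} → x ∈ words αbs → y ∈ freeA → y < x → y ∈ words αbs
    closed x∈ y∈ y<x with ∈-filter⁻ notMax? y∈
    ... | y∈int , y∉max with maxima-or-words αbs (earlier-in-prefix α (Mk ∷ wk) U
                               (smaller-before-words noC x∈ (interval-∈σ n ≤-refl y∈int) y<x) (words-in-α x∈))
    ...   | inj₁ y∈max = ⊥-elim (y∉max y∈max)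
    ...   | inj₂ y∈words = y∈words

  -- A ConfigA with middle entry b in α contradicts CondA: b is no maximum,
  -- so it lies in the prefix w₁⋯w_{k-1} of freeA, which contains a before b.
  noConfigA-α : (αbs ≢ [] → CondA n αbs) → ∀ {c b a} → b ∈ α →
    Precedes σ c b → Precedes σ b a → b < c → a < b → ⊥
  noConfigA-α cond b∈α cb ba b<c a<b with maxima-or-words αbs b∈α
  ... | inj₁ b∈max = <-asym b<c (maximum-precedes b∈max cb)
  ... | inj₂ b∈words = precedes-asym U (⊆-trans a-before-b (⊆-trans (words-⊆ αbs) α⊆σ)) ba
    where
    prefix = cond (nonempty b∈words)
    a∈free : _ ∈ freeA
    a∈free = freeA-∈ (precedes-∈ʳ ba) (<-trans a<b (All.lookup α<Mk b∈α))
                     (λ a∈max → <-asym a<b (maximum-precedes a∈max ba))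
    a-before-b = subst (λ t → Precedes t _ _) (sym prefix)
      (Increasing.take-precedes (length (words αbs)) freeA freeA-sorted (subst (_ ∈_) prefix b∈words) a∈free a<b)

  -- A ConfigA with middle entry b in wk gives b a d or b d a in wk: 213 or 231.
  noConfigA-wk : Avoids (renorm wk) p231 → Avoids (renorm wk) p213 → ∀ {b a d} → b ∈ wk →
    Precedes σ b a → Precedes σ b d → a < b → b < d → ⊥
  noConfigA-wk no231 no213 b∈ ba bd a<b b<d
    with precedes-total (after-wk b∈ ba) (after-wk b∈ bd) (<⇒≢ (<-trans a<b b<d))
  ... | inj₁ ad = no213 (contains-renorm⁺ wk (_ , precedes-chain Uwk (precedes-wk b∈ ba) ad ,
          sameOrder3 (fall a<b lit<) (rise b<d lit<) (rise (<-trans a<b b<d) lit<)))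
  ... | inj₂ da = no231 (contains-renorm⁺ wk (_ , precedes-chain Uwk (precedes-wk b∈ bd) da ,
          sameOrder3 (rise b<d lit<) (fall a<b lit<) (fall (<-trans a<b b<d) lit<)))

  noConfigA : Avoids (renorm wk) p231 → Avoids (renorm wk) p213 → (αbs ≢ [] → CondA n αbs) → ¬ ConfigA σ
  noConfigA no231 no213 cond (c , b , a , d , cb , ba , bd , b<c , a<b , b<d) with locate (precedes-∈ʳ cb)
  ... | in-α b∈α = noConfigA-α cond b∈α cb ba b<c a<b
  ... | is-Mk b≡Mk = <-irrefl b≡Mk (<-≤-trans b<d (σ≤Mk (precedes-∈ʳ bd)))
  ... | in-wk b∈wk = noConfigA-wk no231 no213 b∈wk ba bd a<b b<d

  partA : (AvoidsAll σ basisA ⇔ (Avoids (renorm wk) p231 × Avoids (renorm wk) p213 × (αbs ≢ [] → CondA n αbs)))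
          × (AvoidsAll σ basisA → Avoids (renorm α) p321)
  partA = mk⇔ forward backward , λ { (no3214 ∷ _) → α-avoids p321 below4 no3214 }
    where
    forward : AvoidsAll σ basisA → Avoids (renorm wk) p231 × Avoids (renorm wk) p213 × (αbs ≢ [] → CondA n αbs)
    forward av@(_ ∷ _ ∷ no4213 ∷ no4231 ∷ []) =
      wk-avoids p231 below4 no4231 , wk-avoids p213 below4 no4213 , λ _ → condA (avoidsA⇒noConfigA U av)
    backward : Avoids (renorm wk) p231 × Avoids (renorm wk) p213 × (αbs ≢ [] → CondA n αbs) → AvoidsAll σ basisA
    backward (no231 , no213 , cond) = noConfigA⇒avoidsA (noConfigA no231 no213 cond)

  condB : ¬ ConfigB σ → CondB [] αbs
  condB noC = condB-intro [] αbs (λ blk → Block.condB-holds blk noC)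

  noConfigB-α : (αbs ≢ [] → CondB [] αbs) → ∀ {c a b} → a ∈ α →
    Precedes σ c a → Precedes σ a b → a < b → b < c → ⊥
  noConfigB-α cond a∈α ca ab a<b b<c with maxima-or-words αbs a∈α
  ... | inj₁ a∈max = <-asym (<-trans a<b b<c) (maximum-precedes a∈max ca)
  ... | inj₂ a∈words with words-block αbs a∈words
  ...   | q , M , w , blk , a∈w =
    Block.condB-excludes blk (condB-elim (cond (nonempty a∈words)) blk) a∈w ca ab a<b b<c

  -- A ConfigB with entry a in wk gives a b d or a d b in wk: 123 or 132.
  noConfigB-wk : Avoids (renorm wk) p123 → Avoids (renorm wk) p132 → ∀ {a b d} → a ∈ wk →
    Precedes σ a b → Precedes σ a d → a < b → b < d → ⊥
  noConfigB-wk no123 no132 a∈ ab ad a<b b<d with precedes-total (after-wk a∈ ab) (after-wk a∈ ad) (<⇒≢ b<d)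
  ... | inj₁ bd = no123 (contains-renorm⁺ wk (_ , precedes-chain Uwk (precedes-wk a∈ ab) bd ,
          sameOrder3 (rise a<b lit<) (rise (<-trans a<b b<d) lit<) (rise b<d lit<)))
  ... | inj₂ db = no132 (contains-renorm⁺ wk (_ , precedes-chain Uwk (precedes-wk a∈ ad) db ,
          sameOrder3 (rise (<-trans a<b b<d) lit<) (rise a<b lit<) (fall b<d lit<)))

  noConfigB : Avoids (renorm wk) p123 → Avoids (renorm wk) p132 → (αbs ≢ [] → CondB [] αbs) → ¬ ConfigB σ
  noConfigB no123 no132 cond (c , a , b , d , ca , ab , ad , a<b , b<c , b<d) with locate (precedes-∈ʳ ca)
  ... | in-α a∈α = noConfigB-α cond a∈α ca ab a<b b<c
  ... | is-Mk a≡Mk = <-irrefl a≡Mk (<-≤-trans (<-trans a<b b<c) (σ≤Mk (precedes-∈ˡ ca)))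
  ... | in-wk a∈wk = noConfigB-wk no123 no132 a∈wk ab ad a<b b<d

  partB : (AvoidsAll σ basisB ⇔ (Avoids (renorm wk) p123 × Avoids (renorm wk) p132 × (αbs ≢ [] → CondB [] αbs)))
          × (AvoidsAll σ basisB → Avoids (renorm α) p312)
  partB = mk⇔ forward backward , λ { (no3124 ∷ _) → α-avoids p312 below4 no3124 }
    where
    forward : AvoidsAll σ basisB → Avoids (renorm wk) p123 × Avoids (renorm wk) p132 × (αbs ≢ [] → CondB [] αbs)
    forward av@(_ ∷ _ ∷ no4123 ∷ no4132 ∷ []) =
      wk-avoids p123 below4 no4123 , wk-avoids p132 below4 no4132 , λ _ → condB (avoidsB⇒noConfigB U av)
    backward : Avoids (renorm wk) p123 × Avoids (renorm wk) p132 × (αbs ≢ [] → CondB [] αbs) → AvoidsAll σ basisB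
    backward (no123 , no132 , cond) = noConfigB⇒avoidsB (noConfigB no123 no132 cond)

theorem1 : (n : ℕ) → 1 ≤ n → (σ : List ℕ) → σ ↭ interval n →
    (αbs : List (ℕ × List ℕ)) (Mk : ℕ) (wk : List ℕ) →
    σ ≡ flatten αbs ++ Mk ∷ wk →
    LRDecomp 0 (αbs ++ (Mk , wk) ∷ []) →
    ((AvoidsAll σ basisA ⇔
        (Avoids (renorm wk) p231 × Avoids (renorm wk) p213 × (αbs ≢ [] → CondA n αbs)))
     × (AvoidsAll σ basisA → Avoids (renorm (flatten αbs)) p321))
    ×
    ((AvoidsAll σ basisB ⇔
        (Avoids (renorm wk) p123 × Avoids (renorm wk) p132 × (αbs ≢ [] → CondB [] αbs)))
     × (AvoidsAll σ basisB → Avoids (renorm (flatten αbs)) p312))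
theorem1 n _ σ σ↭ αbs Mk wk refl lr = partA , partB
  where open Decomposition n αbs Mk wk σ↭ lr
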